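{- Let $r\ge2$ and let $M$ be the monoid with presentation $\langle x_1,\ldots,x_r\mid x_ix_1=x_1^2\text{ for all }i=2,\ldots,r\rangle$. Then $M$ is homogeneously finitely generated, left cancellative, and every pair of elements of $M$ has a least (with respect to $\le_L$) common right multiple; consequently $\mathcal{L}:=(M,\le_L)$ is an upho lattice. Its core is the lattice $M_r$, and $F(\mathcal{L};x)^{ -1}=\chi^*(M_r;x)=1-rx+(r-1)x^2$.
   Context: A monoid is homogeneously finitely generated if it has a presentation with finitely many generators in which every relation $w=w'$ has $w,w'$ words of equal length. Left cancellative: $ab=ac$ implies $b=c$. Left divisibility: $a\le_L b$ iff $ax=b$ for some $x\in M$; $b$ is then a right multiple of $a$. $M_r$ denotes the unique finite graded lattice of rank two with exactly $r$ atoms. A poset $\mathcal{P}$ is finite type $\mathbb{N}$-graded if it has a minimum $\hat0$, a rank function $\rho:\mathcal{P}\to\mathbb{N}$ with $\rho(\hat0)=0$ such that every maximal chain has the form $\hat0=x_0\lessdot x_1\lessdot\cdots$ with $\rho(x_i)=i$, and finitely many elements of each rank. An upho lattice is a finite type $\mathbb{N}$-graded lattice $\mathcal{L}$ with at least two elements such that for every $p\in\mathcal{L}$ the principal filter $\{q\ge p\}$ is isomorphic to $\mathcal{L}$. Its core is $[\hat0,s_1\vee\cdots\vee s_r]$ with $s_i$ the atoms. The rank generating function is $F(\mathcal{L};x)=\sum_{p\in\mathcal{L}}x^{\rho(p)}$, and for a finite graded lattice $L$, $\chi^*(L;x)=\sum_{p\in L}\mu(\hat0,p)x^{\rho(p)}$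 with $\mu$ the Möbius function. -}

module Defs where

open import Level using (0ℓ)
open import Data.Nat as ℕ using (ℕ; zero; suc; _<_)
open import Data.Integer as ℤ using (ℤ; +_; -_)
open import Data.Fin as Fin using (Fin)
open import Data.List using (List; []; _∷_; _++_; map; length; filter; foldr)
open import Data.List.Membership.Propositional using (_∈_)
open import Data.List.Relation.Unary.All using (All)
open import Data.List.Relation.Unary.Any using (Any)
open import Data.List.Relation.Unary.AllPairs using (AllPairs)
open import Data.List.Base using (allFin)
open import Data.Product using (Σ; ∃; ∃₂; _×_; _,_; proj₁)
open import Data.Sum using (_⊎_)
open import Relation.Nullary using (¬_; Dec; yes; no)
open import Relation.Nullary.Decidable using (map′)
open import Relation.Binary using (Rel; IsPartialOrder)
open import Relation.Binary.PropositionalEquality using (_≡_; refl)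
open import Relation.Binary.Construct.Closure.Equivalence using (EqClosure)
open import Algebra.Bundles using (RawMonoid)
open import Algebra.Morphism.Structures using (module MonoidMorphisms)
import Algebra.Definitions.RawMagma as RawMagmaDefs

Word : ℕ → Set
Word n = List (Fin n)

Relation : ℕ → Set
Relation n = Word n × Word n

data Step {n : ℕ} (R : List (Relation n)) : Rel (Word n) 0ℓ where
  step : ∀ (u v : Word n) {l r : Word n} → (l , r) ∈ R →
         Step R (u ++ l ++ v) (u ++ r ++ v)

_≈[_]_ : {n : ℕ} → Word n → List (Relation n) → Word n → Set
w ≈[ R ] w' = EqClosure (Step R) w w'

Presented : (n : ℕ) → List (Relation n) → RawMonoid 0ℓ 0ℓ
Presented n R = record
  { Carrier = Word n
  ; _≈_     = λ w w' → w ≈[ R ] w'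
  ; _∙_     = _++_
  ; ε       = []
  }

Homogeneous : {n : ℕ} → Relation n → Set
Homogeneous (w , w') = length w ≡ length w'

HomogeneouslyFinitelyGenerated : RawMonoid 0ℓ 0ℓ → Set
HomogeneouslyFinitelyGenerated M =
  Σ ℕ λ n → Σ (List (Relation n)) λ R → All Homogeneous R ×
    ∃ λ (f : RawMonoid.Carrier M → Word n) →
      MonoidMorphisms.IsMonoidIsomorphism M (Presented n R) f

LeftDiv : (M : RawMonoid 0ℓ 0ℓ) → Rel (RawMonoid.Carrier M) 0ℓ
LeftDiv M a b = RawMagmaDefs._∣ˡ_ (RawMonoid.rawMagma M) a b

HasLeastCommonRightMultiples : RawMonoid 0ℓ 0ℓ → Set
HasLeastCommonRightMultiples M = ∀ a b → ∃ λ m →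
  LeftDiv M a m × LeftDiv M b m ×
  (∀ c → LeftDiv M a c → LeftDiv M b c → LeftDiv M m c)

-- The monoid of the theorem:
--   ⟨ x₁ … x_r ∣ xᵢ x₁ = x₁ x₁ (i = 2 … r) ⟩
-- with x₁ = Fin.zero and x_{j+2} = Fin.suc j.

relsM : (r : ℕ) → List (Relation r)
relsM zero    = []
relsM (suc m) = map (λ j → (Fin.suc j ∷ Fin.zero ∷ [] , Fin.zero ∷ Fin.zero ∷ []))
                    (allFin m)

MonoidM : ℕ → RawMonoid 0ℓ 0ℓ
MonoidM r = Presented r (relsM r)

module Order {A : Set} (_≈_ : Rel A 0ℓ) (_≤_ : Rel A 0ℓ) where

  _<_ₒ : Rel A 0ℓ
  p < q ₒ = p ≤ q × ¬ (p ≈ q)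

  _⋖_ : Rel A 0ℓ
  p ⋖ q = (p < q ₒ) × (∀ z → p ≤ z → z ≤ q → (z ≈ p) ⊎ (z ≈ q))

  IsLUB : A → A → A → Set
  IsLUB p q j = p ≤ j × q ≤ j × (∀ u → p ≤ u → q ≤ u → j ≤ u)

  IsGLB : A → A → A → Set
  IsGLB p q m = m ≤ p × m ≤ q × (∀ u → u ≤ p → u ≤ q → u ≤ m)

  Filter : A → Set
  Filter p = Σ A (λ q → p ≤ q)

  Interval : A → A → Set
  Interval b t = Σ A (λ q → b ≤ q × q ≤ t)

  RankCount : (A → ℕ) → ℕ → ℕ → Set
  RankCount ρ n k = Σ (List A) λ l → length l ≡ k ×
    All (λ p → ρ p ≡ n) l × AllPairs (λ p q → ¬ (p ≈ q)) l ×
    (∀ p → ρ p ≡ n → Any (p ≈_) l)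

record OrderIso {A₁ A₂ : Set} (_≈₁_ _≤₁_ : Rel A₁ 0ℓ) (_≈₂_ _≤₂_ : Rel A₂ 0ℓ) : Set where
  field
    to        : A₁ → A₂
    from      : A₂ → A₁
    to-cong   : ∀ {x y} → x ≈₁ y → to x ≈₂ to y
    from-cong : ∀ {x y} → x ≈₂ y → from x ≈₁ from y
    from-to   : ∀ x → from (to x) ≈₁ x
    to-from   : ∀ y → to (from y) ≈₂ y
    to-mono   : ∀ {x y} → x ≤₁ y → to x ≤₂ to y
    from-mono : ∀ {x y} → x ≤₂ y → from x ≤₁ from y

-- Upho lattice with rank function ρ.
-- "Finite type ℕ-graded" is expressed as: a minimum 0̂ with ρ 0̂ = 0,
-- ρ strictly monotone, covers raise rank by exactly one, and finitely
-- many elements of each rank.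
record IsUphoLattice {A : Set} (_≈_ _≤_ : Rel A 0ℓ) (ρ : A → ℕ) : Set₁ where
  open Order _≈_ _≤_
  field
    isPartialOrder : IsPartialOrder _≈_ _≤_
    bottom         : A
    bottom-min     : ∀ p → bottom ≤ p
    ρ-cong         : ∀ {p q} → p ≈ q → ρ p ≡ ρ q
    ρ-bottom       : ρ bottom ≡ 0
    ρ-strict       : ∀ {p q} → p < q ₒ → ρ p ℕ.< ρ q
    ρ-cover        : ∀ {p q} → p ⋖ q → ρ q ≡ suc (ρ p)
    finiteType     : ∀ n → Σ (List A) λ l → ∀ p → ρ p ≡ n → Any (p ≈_) l
    joins          : ∀ p q → ∃ (IsLUB p q)
    meets          : ∀ p q → ∃ (IsGLB p q)
    twoElements    : ∃₂ λ p q → ¬ (p ≈ q)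
    upho           : ∀ p → OrderIso {Filter p} {A}
                              (λ x y → proj₁ x ≈ proj₁ y) (λ x y → proj₁ x ≤ proj₁ y)
                              _≈_ _≤_

-- Power series: F⁻¹ = c  means  Σ_{k ≤ n} c k · a (n - k) = [n = 0]

sumUpTo : ℕ → (ℕ → ℤ) → ℤ
sumUpTo zero    f = f 0
sumUpTo (suc n) f = sumUpTo n f ℤ.+ f (suc n)

δ₀ : ℕ → ℤ
δ₀ zero    = + 1
δ₀ (suc _) = + 0

IsInverseSeries : (a : ℕ → ℕ) (c : ℕ → ℤ) → Set
IsInverseSeries a c = ∀ n → sumUpTo n (λ k → c k ℤ.* + a (n ℕ.∸ k)) ≡ δ₀ n

poly : ℕ → ℕ → ℤ
poly r 0 = + 1
poly r 1 = - (+ r)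
poly r 2 = + r ℤ.- + 1
poly r (suc (suc (suc _))) = + 0

data MrEl (r : ℕ) : Set where
  bot  : MrEl r
  atom : Fin r → MrEl r
  top  : MrEl r

data _≤Mr_ {r : ℕ} : MrEl r → MrEl r → Set where
  bot≤  : ∀ {x} → bot ≤Mr x
  ≤top  : ∀ {x} → x ≤Mr top
  atom≤ : ∀ {i} → atom i ≤Mr atom i

_≤Mr?_ : {r : ℕ} (x y : MrEl r) → Dec (x ≤Mr y)
bot ≤Mr? y = yes bot≤
atom i ≤Mr? bot = no λ ()
atom i ≤Mr? atom j with i Fin.≟ j
... | yes refl = yes atom≤
... | no i≢j   = no λ { atom≤ → i≢j refl }
atom i ≤Mr? top = yes ≤top
top ≤Mr? bot = no λ ()
top ≤Mr? atom j = no λ ()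
top ≤Mr? top = yes ≤top

rankMr : {r : ℕ} → MrEl r → ℕ
rankMr bot      = 0
rankMr (atom _) = 1
rankMr top      = 2

enumMr : (r : ℕ) → List (MrEl r)
enumMr r = bot ∷ map atom (allFin r) ++ top ∷ []

sumℤ : List ℤ → ℤ
sumℤ = foldr ℤ._+_ (+ 0)

IsMobiusMr : (r : ℕ) → (MrEl r → ℤ) → Set
IsMobiusMr r μ = μ bot ≡ + 1 ×
  (∀ y → ¬ (y ≡ bot) → sumℤ (map μ (filter (_≤Mr? y) (enumMr r))) ≡ + 0)

chiStarCoeff : (r : ℕ) → (MrEl r → ℤ) → ℕ → ℤ
chiStarCoeff r μ k = sumℤ (map μ (filter (λ p → rankMr p ℕ.≟ k) (enumMr r)))

module Submission where

-- Since xᵢ x₁ = x₁ x₁ for every i, an occurrence of x₁ absorbs everything to its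
-- left: w x₁ = x₁^(|w|+1). So every element has a unique normal form x₁ᵏ t with t a
-- word in x₂ … x_r, multiplication of normal forms is explicit, and x₁ᵏ s left-divides
-- x₁ᴷ t exactly when k + |s| < K, or k = K and s is a prefix of t. Left cancellation,
-- least common right multiples and greatest common left divisors are read off from
-- this description. The relations are homogeneous, so length is a rank function, and
-- left cancellation identifies each principal filter pM with M. There are
-- 1 + m + ⋯ + mⁿ elements of rank n (m = r - 1), so the rank generating function is
-- 1 / ((1 - x)(1 - m x)) = 1 / (1 - r x + (r - 1) x²). The atoms are the generators,
-- their join is x₁x₁ = xᵢx₁, and [1, x₁x₁] = {1, x₁, …, x_r, x₁x₁} ≅ M_r.

open import Defs
open import Algebra.Bundles using (RawMonoid; Monoid)
open import Algebra.Definitions using (LeftCancellative)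
import Algebra.Morphism.Construct.Identity as Identity
import Algebra.Properties.Monoid.Divisibility as Divisibility
open import Algebra.Structures using (IsMonoid)
open import Data.Empty using (⊥-elim)
open import Data.Fin as Fin using (Fin; zero; suc)
open import Data.Integer using (ℤ)
import Data.Integer as ℤ
import Data.Integer.Properties as ℤ
import Data.Integer.Tactic.RingSolver as ℤ-Solver
open import Data.List
  using (List; []; _∷_; _++_; _∷ʳ_; length; map; replicate; foldr; filter; take; allFin; cartesianProductWith)
open import Data.List.Membership.Propositional using (_∈_; _∉_)
import Data.List.Membership.Propositional.Properties as List
import Data.List.Properties as List
open import Data.List.Relation.Binary.Disjoint.Propositional using (Disjoint)
import Data.List.Relation.Binary.Pointwise as Pointwise
open import Data.List.Relation.Binary.Prefix.Heterogeneous using (Prefix; []; _∷_; _++ᵖ_)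
open import Data.List.Relation.Binary.Prefix.Heterogeneous.Properties using (fromPointwise; prefix?)
open import Data.List.Relation.Binary.Prefix.Propositional.Properties using (Prefix-as-∣ˡ)
open import Data.List.Relation.Unary.All as All using (All; []; _∷_)
import Data.List.Relation.Unary.All.Properties as All
open import Data.List.Relation.Unary.AllPairs as AllPairs using ([]; _∷_)
import Data.List.Relation.Unary.AllPairs.Properties as AllPairs
open import Data.List.Relation.Unary.Any as Any using (Any; here; there)
import Data.List.Relation.Unary.Any.Properties as Any
open import Data.List.Relation.Unary.Unique.Propositional using (Unique)
import Data.List.Relation.Unary.Unique.Propositional.Properties as Unique
open import Data.Nat as ℕ using (ℕ; zero; suc; _+_; _*_; _^_; _∸_; _≤_; _<_; z≤n; s≤s)
import Data.Nat.Properties as ℕ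
import Data.Nat.Tactic.RingSolver as ℕ-Solver
open import Data.Product using (Σ; ∃; _×_; _,_; proj₁; proj₂; map₁)
open import Data.Sum using (_⊎_; inj₁; inj₂)
open import Function using (_∘_; id)
open import Level using (0ℓ)
open import Relation.Binary using (IsEquivalence; IsPartialOrder; tri<; tri≈; tri>)
import Relation.Binary.Construct.Closure.Equivalence as EqClosure
open import Relation.Binary.Definitions using (DecidableEquality)
open import Relation.Binary.PropositionalEquality as ≡
  using (_≡_; refl; sym; trans; cong; cong₂; subst; subst₂; isEquivalence; module ≡-Reasoning)
open import Relation.Nullary using (¬_; Dec; yes; no; contradiction)

module PresentedMonoid {n : ℕ} (R : List (Relation n)) where

  open RawMonoid (Presented n R) public using (_≈_)

  step-++ˡ : ∀ u {x y} → Step R x y → Step R (u ++ x) (u ++ y)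
  step-++ˡ u (step v w lr∈R) =
    subst₂ (Step R) (List.++-assoc u v _) (List.++-assoc u v _) (step (u ++ v) w lr∈R)

  step-++ʳ : ∀ v {x y} → Step R x y → Step R (x ++ v) (y ++ v)
  step-++ʳ v (step u w {l} {r} lr∈R) = subst₂ (Step R) (reassoc l) (reassoc r) (step u (w ++ v) lr∈R)
    where
    reassoc : ∀ s → u ++ s ++ w ++ v ≡ (u ++ s ++ w) ++ v
    reassoc s = sym (trans (List.++-assoc u (s ++ w) v) (cong (u ++_) (List.++-assoc s w v)))

  ≈-isEquivalence : IsEquivalence _≈_
  ≈-isEquivalence = EqClosure.isEquivalence (Step R)

  open IsEquivalence ≈-isEquivalence using () renaming (refl to ≈-refl; reflexive to ≈-reflexive)

  ++-cong : ∀ {x x′ y y′} → x ≈ x′ → y ≈ y′ → x ++ y ≈ x′ ++ y′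
  ++-cong {x′ = x′} {y} x≈x′ y≈y′ = EqClosure.transitive (Step R)
    (EqClosure.gmap (_++ y) (step-++ʳ y) x≈x′) (EqClosure.gmap (x′ ++_) (step-++ˡ x′) y≈y′)

  isMonoid : IsMonoid _≈_ _++_ []
  isMonoid = record
    { isSemigroup = record
      { isMagma = record { isEquivalence = ≈-isEquivalence ; ∙-cong = ++-cong }
      ; assoc   = λ x y z → ≈-reflexive (List.++-assoc x y z)
      }
    ; identity = (λ _ → ≈-refl) , (λ x → ≈-reflexive (List.++-identityʳ x))
    }

  monoid : Monoid 0ℓ 0ℓ
  monoid = record { isMonoid = isMonoid }

  homogeneouslyFinitelyGenerated : All Homogeneous R → HomogeneouslyFinitelyGenerated (Presented n R)
  homogeneouslyFinitelyGenerated homogeneous =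
    n , R , homogeneous , id , Identity.isMonoidIsomorphism (Presented n R) ≈-refl

module HomogeneousPresentation {n : ℕ} {R : List (Relation n)} (homogeneous : All Homogeneous R) where

  open PresentedMonoid R
  open IsEquivalence ≈-isEquivalence using ()
    renaming (refl to ≈-refl; reflexive to ≈-reflexive; trans to ≈-trans)
  open Divisibility monoid using (_∣ˡ_; _,_; ε∣ˡ_; ∣ˡ-isPreorder)
  open Order _≈_ _∣ˡ_

  length-step : ∀ {x y} → Step R x y → length x ≡ length y
  length-step (step u v {l} {r} lr∈R) = begin
    length (u ++ l ++ v)             ≡⟨ List.length-++ u ⟩
    length u + length (l ++ v)       ≡⟨ cong (length u +_) (List.length-++ l) ⟩
    length u + (length l + length v) ≡⟨ cong (λ k → length u + (k + length v)) |l|≡|r| ⟩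
    length u + (length r + length v) ≡⟨ cong (length u +_) (List.length-++ r) ⟨
    length u + length (r ++ v)       ≡⟨ List.length-++ u ⟨
    length (u ++ r ++ v)             ∎
    where
    open ≡-Reasoning
    |l|≡|r| = All.lookup homogeneous lr∈R

  length-cong : ∀ {x y} → x ≈ y → length x ≡ length y
  length-cong = EqClosure.gfold isEquivalence length length-step

  length-∣ˡ : ∀ {x y} (x∣y : x ∣ˡ y) → length x + length (_∣ˡ_.quotient x∣y) ≡ length y
  length-∣ˡ {x} (q , xq≈y) = trans (sym (List.length-++ x)) (length-cong xq≈y)

  ∣ˡ⇒length≤ : ∀ {x y} → x ∣ˡ y → length x ≤ length y
  ∣ˡ⇒length≤ x∣y = subst (_ ≤_) (length-∣ˡ x∣y) (ℕ.m≤m+n _ _)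

  ++[]≈⇒≈ : ∀ {x y} → x ++ [] ≈ y → x ≈ y
  ++[]≈⇒≈ {x} = ≈-trans (≈-reflexive (sym (List.++-identityʳ x)))

  ∣ˡ∧length≤⇒≈ : ∀ {x y} → x ∣ˡ y → length y ≤ length x → x ≈ y
  ∣ˡ∧length≤⇒≈ ([] , x≈y) _ = ++[]≈⇒≈ x≈y
  ∣ˡ∧length≤⇒≈ {x} x∣y@(_ ∷ _ , _) y≤x =
    ⊥-elim (ℕ.m+1+n≰m (length x) (subst (_≤ length x) (sym (length-∣ˡ x∣y)) y≤x))

  ∣ˡ-antisym : ∀ {x y} → x ∣ˡ y → y ∣ˡ x → x ≈ y
  ∣ˡ-antisym x∣y y∣x = ∣ˡ∧length≤⇒≈ x∣y (∣ˡ⇒length≤ y∣x)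

  ∣ˡ-isPartialOrder : IsPartialOrder _≈_ _∣ˡ_
  ∣ˡ-isPartialOrder = record { isPreorder = ∣ˡ-isPreorder ; antisym = ∣ˡ-antisym }

  length-strict : ∀ {x y} → x < y ₒ → length x < length y
  length-strict (x∣y , x≉y) =
    ℕ.≤∧≢⇒< (∣ˡ⇒length≤ x∣y) (λ eq → x≉y (∣ˡ∧length≤⇒≈ x∣y (ℕ.≤-reflexive (sym eq))))

  length-∷ʳ : ∀ x (c : Fin n) → length (x ∷ʳ c) ≡ suc (length x)
  length-∷ʳ x c = trans (List.length-++ x) (ℕ.+-comm (length x) 1)

  length-cover : ∀ {x y} → x ⋖ y → length y ≡ suc (length x)
  length-cover ((([] , x≈y) , x≉y) , _) = ⊥-elim (x≉y (++[]≈⇒≈ x≈y))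
  length-cover {x} (((c ∷ q , xcq≈y) , _) , between)
    with between (x ∷ʳ c) (c ∷ [] , ≈-refl) (q , ≈-trans (≈-reflexive (List.++-assoc x (c ∷ []) q)) xcq≈y)
  ... | inj₁ xc≈x = ⊥-elim (ℕ.1+n≢n (trans (sym (length-∷ʳ x c)) (length-cong xc≈x)))
  ... | inj₂ xc≈y = trans (sym (length-cong xc≈y)) (length-∷ʳ x c)

  ε⋖[_] : ∀ c → [] ⋖ (c ∷ [])
  ε⋖[ c ] = ((ε∣ˡ (c ∷ [])) , λ ε≈c → ℕ.0≢1+n (length-cong ε≈c)) , between
    where
    between : ∀ z → [] ∣ˡ z → z ∣ˡ (c ∷ []) → z ≈ [] ⊎ z ≈ (c ∷ [])
    between []      _ _   = inj₁ ≈-refl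
    between (_ ∷ _) _ z∣c = inj₂ (∣ˡ∧length≤⇒≈ z∣c (s≤s z≤n))

module LeftCancellativeMonoid
  (M : Monoid 0ℓ 0ℓ) (cancelˡ : LeftCancellative (Monoid._≈_ M) (Monoid._∙_ M)) where

  open Monoid M renaming (refl to ≈-refl; sym to ≈-sym; trans to ≈-trans)
  open Divisibility M using (_∣ˡ_; _,_; x∣ˡy⇒zx∣ˡzy)
  open Order _≈_ _∣ˡ_ using (Filter)
  open import Relation.Binary.Reasoning.Setoid setoid

  filter≅carrier : ∀ p → OrderIso {Filter p} {Carrier}
    (λ x y → proj₁ x ≈ proj₁ y) (λ x y → proj₁ x ∣ˡ proj₁ y) _≈_ _∣ˡ_
  filter≅carrier p = record
    { to        = λ x → quotient (proj₂ x)
    ; from      = λ y → p ∙ y , (y , ≈-refl)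
    ; to-cong   = λ {x} {y} → to-cong (proj₂ x) (proj₂ y)
    ; from-cong = ∙-congˡ
    ; from-to   = λ x → equality (proj₂ x)
    ; to-from   = λ _ → ≈-refl
    ; to-mono   = λ {x} {y} → to-mono (proj₂ x) (proj₂ y)
    ; from-mono = x∣ˡy⇒zx∣ˡzy p
    }
    where
    open _∣ˡ_
    to-cong : ∀ {a b} (p∣a : p ∣ˡ a) (p∣b : p ∣ˡ b) → a ≈ b → quotient p∣a ≈ quotient p∣b
    to-cong (u , pu≈a) (v , pv≈b) a≈b = cancelˡ p u v (≈-trans pu≈a (≈-trans a≈b (≈-sym pv≈b)))
    to-mono : ∀ {a b} (p∣a : p ∣ˡ a) (p∣b : p ∣ˡ b) → a ∣ˡ b → quotient p∣a ∣ˡ quotient p∣b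
    to-mono (u , pu≈a) (v , pv≈b) (w , aw≈b) = w , cancelˡ p _ _ (begin
      p ∙ (u ∙ w) ≈⟨ assoc p u w ⟨
      (p ∙ u) ∙ w ≈⟨ ∙-congʳ pu≈a ⟩
      _ ∙ w       ≈⟨ aw≈b ⟩
      _           ≈⟨ pv≈b ⟨
      p ∙ v       ∎)

module PrefixOrder {A : Set} (_≟_ : DecidableEquality A) where

  infix 4 _⊑_
  _⊑_ : List A → List A → Set
  _⊑_ = Prefix _≡_

  ⊑-refl : ∀ s → s ⊑ s
  ⊑-refl s = fromPointwise (Pointwise.refl refl)

  ⊑-total-below : ∀ {u v t} → u ⊑ t → v ⊑ t → u ⊑ v ⊎ v ⊑ u
  ⊑-total-below []           _            = inj₁ []
  ⊑-total-below (_ ∷ _)      []           = inj₂ []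
  ⊑-total-below (refl ∷ u⊑t) (refl ∷ v⊑t) with ⊑-total-below u⊑t v⊑t
  ... | inj₁ u⊑v = inj₁ (refl ∷ u⊑v)
  ... | inj₂ v⊑u = inj₂ (refl ∷ v⊑u)

  take-⊑ : ∀ n s → take n s ⊑ s
  take-⊑ zero    s       = []
  take-⊑ (suc n) []      = []
  take-⊑ (suc n) (a ∷ s) = refl ∷ take-⊑ n s

  ⊑-take : ∀ {u s} n → u ⊑ s → length u ≤ n → u ⊑ take n s
  ⊑-take n       []           _         = []
  ⊑-take (suc n) (refl ∷ u⊑s) (s≤s u≤n) = refl ∷ ⊑-take n u⊑s u≤n

  lcp : List A → List A → List A
  lcp (a ∷ s) (b ∷ t) with a ≟ b
  ... | yes _ = a ∷ lcp s t
  ... | no  _ = []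
  lcp _ _ = []

  lcp-⊑ˡ : ∀ s t → lcp s t ⊑ s
  lcp-⊑ˡ []      _       = []
  lcp-⊑ˡ (a ∷ s) []      = []
  lcp-⊑ˡ (a ∷ s) (b ∷ t) with a ≟ b
  ... | yes _ = refl ∷ lcp-⊑ˡ s t
  ... | no  _ = []

  lcp-⊑ʳ : ∀ s t → lcp s t ⊑ t
  lcp-⊑ʳ []      _       = []
  lcp-⊑ʳ (a ∷ s) []      = []
  lcp-⊑ʳ (a ∷ s) (b ∷ t) with a ≟ b
  ... | yes refl = refl ∷ lcp-⊑ʳ s t
  ... | no  _    = []

  ⊑-lcp : ∀ {u s t} → u ⊑ s → u ⊑ t → u ⊑ lcp s t
  ⊑-lcp []                            _            = []
  ⊑-lcp {a ∷ _} (refl ∷ u⊑s) (refl ∷ u⊑t) with a ≟ a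
  ... | yes _  = refl ∷ ⊑-lcp u⊑s u⊑t
  ... | no a≢a = contradiction refl a≢a

length-allFin : ∀ n → length (allFin n) ≡ n
length-allFin n = List.length-tabulate id

length-cartesianProductWith : ∀ {A B C : Set} (f : A → B → C) xs ys →
  length (cartesianProductWith f xs ys) ≡ length xs * length ys
length-cartesianProductWith f []       ys = refl
length-cartesianProductWith f (x ∷ xs) ys = begin
  length (map (f x) ys ++ cartesianProductWith f xs ys)         ≡⟨ List.length-++ (map (f x) ys) ⟩
  length (map (f x) ys) + length (cartesianProductWith f xs ys) ≡⟨ cong₂ _+_ (List.length-map (f x) ys)
                                                                            (length-cartesianProductWith f xs ys) ⟩
  length ys + length xs * length ys                             ∎
  where open ≡-Reasoning

module InverseSeries where

  open import Data.Integer.Base using (+_; 0ℤ; 1ℤ)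

  sumUpTo-vanishing : ∀ (f : ℕ → ℤ) → (∀ j → f (3 + j) ≡ + 0) → ∀ n → sumUpTo (2 + n) f ≡ sumUpTo 2 f
  sumUpTo-vanishing f f≡0 zero    = refl
  sumUpTo-vanishing f f≡0 (suc n) rewrite f≡0 n = trans (ℤ.+-identityʳ _) (sumUpTo-vanishing f f≡0 n)

  isInverseSeries-poly : ∀ m (a : ℕ → ℕ) → a 0 ≡ 1 → a 1 ≡ suc m →
    (∀ n → a (2 + n) + m * a n ≡ suc m * a (1 + n)) → IsInverseSeries a (poly (suc m))
  isInverseSeries-poly m a a₀≡1 a₁≡1+m recurrence = inverse
    where
    M : ℤ
    M = + m

    inverse : IsInverseSeries a (poly (suc m))
    inverse zero rewrite a₀≡1 = refl
    inverse (suc zero) rewrite a₀≡1 | a₁≡1+m = cancel M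
      where
      cancel : ∀ M → 1ℤ ℤ.* (1ℤ ℤ.+ M) ℤ.+ ℤ.- (1ℤ ℤ.+ M) ℤ.* 1ℤ ≡ 0ℤ
      cancel = ℤ-Solver.solve-∀
    inverse (suc (suc n)) = begin
      sumUpTo (2 + n) f
        ≡⟨ sumUpTo-vanishing f (λ j → ℤ.*-zeroˡ (+ a (2 + n ∸ (3 + j)))) n ⟩
      1ℤ ℤ.* A₂ ℤ.+ ℤ.- (1ℤ ℤ.+ M) ℤ.* A₁ ℤ.+ ((1ℤ ℤ.+ M) ℤ.- 1ℤ) ℤ.* A₀
        ≡⟨ rearrange M A₀ A₁ A₂ ⟩
      (A₂ ℤ.+ M ℤ.* A₀) ℤ.- (1ℤ ℤ.+ M) ℤ.* A₁
        ≡⟨ cong (λ x → x ℤ.- (1ℤ ℤ.+ M) ℤ.* A₁) recurrenceℤ ⟩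
      (1ℤ ℤ.+ M) ℤ.* A₁ ℤ.- (1ℤ ℤ.+ M) ℤ.* A₁
        ≡⟨ ℤ.+-inverseʳ ((1ℤ ℤ.+ M) ℤ.* A₁) ⟩
      0ℤ ∎
      where
      open ≡-Reasoning
      f = λ k → poly (suc m) k ℤ.* + a (2 + n ∸ k)
      A₀ = + a n
      A₁ = + a (1 + n)
      A₂ = + a (2 + n)
      rearrange : ∀ M A₀ A₁ A₂ → 1ℤ ℤ.* A₂ ℤ.+ ℤ.- (1ℤ ℤ.+ M) ℤ.* A₁ ℤ.+ ((1ℤ ℤ.+ M) ℤ.- 1ℤ) ℤ.* A₀
                               ≡ (A₂ ℤ.+ M ℤ.* A₀) ℤ.- (1ℤ ℤ.+ M) ℤ.* A₁
      rearrange = ℤ-Solver.solve-∀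
      recurrenceℤ : A₂ ℤ.+ M ℤ.* A₀ ≡ (1ℤ ℤ.+ M) ℤ.* A₁
      recurrenceℤ = begin
        A₂ ℤ.+ M ℤ.* A₀          ≡⟨ cong (λ x → A₂ ℤ.+ x) (ℤ.pos-* m (a n)) ⟨
        + (a (2 + n) + m * a n)  ≡⟨ cong +_ (recurrence n) ⟩
        + (suc m * a (1 + n))    ≡⟨ ℤ.pos-* (suc m) (a (1 + n)) ⟩
        (1ℤ ℤ.+ M) ℤ.* A₁        ∎

module MobiusMr (r : ℕ) where

  open import Data.Integer.Base using (+_; 0ℤ; 1ℤ; -1ℤ)

  μ : MrEl r → ℤ
  μ bot      = 1ℤ
  μ (atom _) = -1ℤ
  μ top      = + r ℤ.- 1ℤ

  Σμ : List (MrEl r) → ℤ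
  Σμ xs = sumℤ (map μ xs)

  Σμ-atoms-++ : ∀ l xs → Σμ (map atom l ++ xs) ≡ ℤ.- + length l ℤ.+ Σμ xs
  Σμ-atoms-++ []      xs = sym (ℤ.+-identityˡ (Σμ xs))
  Σμ-atoms-++ (_ ∷ l) xs = trans (cong (λ s → -1ℤ ℤ.+ s) (Σμ-atoms-++ l xs)) (regroup (+ length l) (Σμ xs))
    where
    regroup : ∀ N S → -1ℤ ℤ.+ (ℤ.- N ℤ.+ S) ≡ ℤ.- (1ℤ ℤ.+ N) ℤ.+ S
    regroup = ℤ-Solver.solve-∀

  module _ {P : MrEl r → Set} (P? : ∀ x → Dec (P x)) where

    filter-atoms-accept : (∀ i → P (atom i)) → ∀ l xs →
                          filter P? (map atom l ++ xs) ≡ map atom l ++ filter P? xs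
    filter-atoms-accept P-atoms l xs = trans (List.filter-++ P? (map atom l) xs)
      (cong (_++ filter P? xs) (List.filter-all P? (All.map⁺ (All.universal P-atoms l))))

    filter-atoms-reject : (∀ i → ¬ P (atom i)) → ∀ l xs → filter P? (map atom l ++ xs) ≡ filter P? xs
    filter-atoms-reject ¬P-atoms l xs = trans (List.filter-++ P? (map atom l) xs)
      (cong (_++ filter P? xs) (List.filter-none P? (All.map⁺ (All.universal ¬P-atoms l))))

  Σμ-below-atom-∉ : ∀ i l → i ∉ l → Σμ (filter (_≤Mr? atom i) (map atom l ++ top ∷ [])) ≡ 0ℤ
  Σμ-below-atom-∉ i []      _   = refl
  Σμ-below-atom-∉ i (j ∷ l) i∉ with j Fin.≟ i
  ... | yes refl = contradiction (here refl) i∉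
  ... | no  _    = Σμ-below-atom-∉ i l (i∉ ∘ there)

  Σμ-below-atom-∈ : ∀ i l → Unique l → i ∈ l → Σμ (filter (_≤Mr? atom i) (map atom l ++ top ∷ [])) ≡ -1ℤ
  Σμ-below-atom-∈ i (j ∷ l) (j∉l ∷ _) (here refl) with j Fin.≟ j
  ... | yes refl = cong (λ s → -1ℤ ℤ.+ s) (Σμ-below-atom-∉ j l (λ j∈l → All.lookup j∉l j∈l refl))
  ... | no  j≢j  = contradiction refl j≢j
  Σμ-below-atom-∈ i (j ∷ l) (j∉l ∷ l!) (there i∈l) with j Fin.≟ i
  ... | yes refl = contradiction refl (All.lookup j∉l i∈l)
  ... | no  _    = Σμ-below-atom-∈ i l l! i∈l

  isMobius : IsMobiusMr r μ
  isMobius = refl , sum≡0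
    where
    sum≡0 : ∀ y → ¬ y ≡ bot → Σμ (filter (_≤Mr? y) (enumMr r)) ≡ 0ℤ
    sum≡0 bot      y≢bot = contradiction refl y≢bot
    sum≡0 (atom i) _     =
      cong (λ s → 1ℤ ℤ.+ s) (Σμ-below-atom-∈ i (allFin r) (Unique.allFin⁺ r) (List.∈-allFin i))
    sum≡0 top      _     = begin
      Σμ (filter (_≤Mr? top) (enumMr r))
        ≡⟨ cong Σμ (List.filter-all (_≤Mr? top) (All.universal (λ _ → ≤top) (enumMr r))) ⟩
      1ℤ ℤ.+ Σμ (map atom (allFin r) ++ top ∷ [])
        ≡⟨ cong (λ s → 1ℤ ℤ.+ s) (Σμ-atoms-++ (allFin r) (top ∷ [])) ⟩
      1ℤ ℤ.+ (ℤ.- + length (allFin r) ℤ.+ ((+ r ℤ.- 1ℤ) ℤ.+ 0ℤ))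
        ≡⟨ cong (λ n → 1ℤ ℤ.+ (ℤ.- + n ℤ.+ ((+ r ℤ.- 1ℤ) ℤ.+ 0ℤ))) (length-allFin r) ⟩
      1ℤ ℤ.+ (ℤ.- + r ℤ.+ ((+ r ℤ.- 1ℤ) ℤ.+ 0ℤ))
        ≡⟨ cancel (+ r) ⟩
      0ℤ ∎
      where
      open ≡-Reasoning
      cancel : ∀ R → 1ℤ ℤ.+ (ℤ.- R ℤ.+ ((R ℤ.- 1ℤ) ℤ.+ 0ℤ)) ≡ 0ℤ
      cancel = ℤ-Solver.solve-∀

  rank≟ : ∀ k (p : MrEl r) → Dec (rankMr p ≡ k)
  rank≟ k p = rankMr p ℕ.≟ k

  chiStar : ∀ k → chiStarCoeff r μ k ≡ poly r k
  chiStar 0 = cong (λ xs → 1ℤ ℤ.+ Σμ xs) (filter-atoms-reject (rank≟ 0) (λ _ ()) (allFin r) (top ∷ []))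
  chiStar 1 = begin
    Σμ (filter (rank≟ 1) (map atom (allFin r) ++ top ∷ []))
      ≡⟨ cong Σμ (filter-atoms-accept (rank≟ 1) (λ _ → refl) (allFin r) (top ∷ [])) ⟩
    Σμ (map atom (allFin r) ++ [])   ≡⟨ Σμ-atoms-++ (allFin r) [] ⟩
    ℤ.- + length (allFin r) ℤ.+ 0ℤ   ≡⟨ ℤ.+-identityʳ _ ⟩
    ℤ.- + length (allFin r)          ≡⟨ cong (λ n → ℤ.- + n) (length-allFin r) ⟩
    ℤ.- + r                          ∎
    where open ≡-Reasoning
  chiStar 2 = trans (cong Σμ (filter-atoms-reject (rank≟ 2) (λ _ ()) (allFin r) (top ∷ []))) (ℤ.+-identityʳ _)
  chiStar (suc (suc (suc k))) = cong Σμ (filter-atoms-reject (rank≟ (3 + k)) (λ _ ()) (allFin r) (top ∷ []))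

relsM-homogeneous : ∀ r → All Homogeneous (relsM r)
relsM-homogeneous zero    = []
relsM-homogeneous (suc m) = All.map⁺ (All.universal (λ _ → refl) (allFin m))

module NormalForm (m : ℕ) where

  open PresentedMonoid (relsM (suc m))
  open IsEquivalence ≈-isEquivalence using ()
    renaming (refl to ≈-refl; sym to ≈-sym; reflexive to ≈-reflexive; trans to ≈-trans)

  NF : Set
  NF = ℕ × List (Fin m)

  ⟦_⟧ : NF → Word (suc m)
  ⟦ k , t ⟧ = replicate k zero ++ map suc t

  size : NF → ℕ
  size (k , t) = k + length t

  infixr 5 _◁_
  _◁_ : Fin (suc m) → NF → NF
  _     ◁ (suc k , t) = suc (suc k) , t
  zero  ◁ (zero  , t) = 1 , t
  suc j ◁ (zero  , t) = zero , j ∷ t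

  nf : Word (suc m) → NF
  nf = foldr _◁_ (zero , [])

  -- A right factor beginning with x₁ turns the whole left factor into a power of x₁.
  infixl 7 _·_
  _·_ : NF → NF → NF
  (k , s) · (zero  , t) = k , s ++ t
  (k , s) · (suc l , t) = suc (k + length s + l) , t

  x₁◁ : ∀ P → zero ◁ P ≡ (suc (proj₁ P) , proj₂ P)
  x₁◁ (zero  , t) = refl
  x₁◁ (suc k , t) = refl

  ◁x₁◁ : ∀ a P → a ◁ zero ◁ P ≡ zero ◁ zero ◁ P
  ◁x₁◁ a (zero  , t) = refl
  ◁x₁◁ a (suc k , t) = refl

  ◁-· : ∀ a P Q → a ◁ (P · Q) ≡ (a ◁ P) · Q
  ◁-· a       (suc k , s) (zero  , t) = refl
  ◁-· a       (suc k , s) (suc l , t) = refl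
  ◁-· zero    (zero  , s) (zero  , t) = refl
  ◁-· zero    (zero  , s) (suc l , t) = refl
  ◁-· (suc j) (zero  , s) (zero  , t) = refl
  ◁-· (suc j) (zero  , s) (suc l , t) = refl

  ·-identityˡ : ∀ Q → (zero , []) · Q ≡ Q
  ·-identityˡ (zero  , t) = refl
  ·-identityˡ (suc l , t) = refl

  nf-++ : ∀ u w → nf (u ++ w) ≡ nf u · nf w
  nf-++ []      w = sym (·-identityˡ (nf w))
  nf-++ (a ∷ u) w = trans (cong (a ◁_) (nf-++ u w)) (◁-· a (nf u) (nf w))

  nf-step : ∀ {x y} → Step (relsM (suc m)) x y → nf x ≡ nf y
  nf-step (step u v lr∈R) with List.∈-map⁻ _ lr∈R
  ... | j , _ , refl = begin
    nf (u ++ suc j ∷ zero ∷ v)    ≡⟨ nf-++ u _ ⟩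
    nf u · (suc j ◁ zero ◁ nf v)  ≡⟨ cong (nf u ·_) (◁x₁◁ (suc j) (nf v)) ⟩
    nf u · (zero ◁ zero ◁ nf v)   ≡⟨ nf-++ u _ ⟨
    nf (u ++ zero ∷ zero ∷ v)     ∎
    where open ≡-Reasoning

  nf-cong : ∀ {x y} → x ≈ y → nf x ≡ nf y
  nf-cong = EqClosure.gfold isEquivalence nf nf-step

  ∷⟦⟧≈⟦◁⟧ : ∀ a P → a ∷ ⟦ P ⟧ ≈ ⟦ a ◁ P ⟧
  ∷⟦⟧≈⟦◁⟧ zero    (zero  , t) = ≈-refl
  ∷⟦⟧≈⟦◁⟧ (suc j) (zero  , t) = ≈-refl
  ∷⟦⟧≈⟦◁⟧ zero    (suc k , t) = ≈-refl
  ∷⟦⟧≈⟦◁⟧ (suc j) (suc k , t) = EqClosure.return (step [] ⟦ k , t ⟧ (List.∈-map⁺ _ (List.∈-allFin j)))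

  ≈⟦nf⟧ : ∀ w → w ≈ ⟦ nf w ⟧
  ≈⟦nf⟧ []      = ≈-refl
  ≈⟦nf⟧ (a ∷ w) = ≈-trans (++-cong {x = a ∷ []} ≈-refl (≈⟦nf⟧ w)) (∷⟦⟧≈⟦◁⟧ a (nf w))

  nf-injective : ∀ {x y} → nf x ≡ nf y → x ≈ y
  nf-injective {x} {y} eq = ≈-trans (≈⟦nf⟧ x) (≈-trans (≈-reflexive (cong ⟦_⟧ eq)) (≈-sym (≈⟦nf⟧ y)))

  nf-⟦⟧ : ∀ P → nf ⟦ P ⟧ ≡ P
  nf-⟦⟧ (zero  , [])    = refl
  nf-⟦⟧ (zero  , j ∷ t) = cong (suc j ◁_) (nf-⟦⟧ (zero , t))
  nf-⟦⟧ (suc k , t)     = trans (cong (zero ◁_) (nf-⟦⟧ (k , t))) (x₁◁ (k , t))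

  ⟦⟧-injective : ∀ {P Q} → ⟦ P ⟧ ≈ ⟦ Q ⟧ → P ≡ Q
  ⟦⟧-injective {P} {Q} ⟦P⟧≈⟦Q⟧ = trans (sym (nf-⟦⟧ P)) (trans (nf-cong ⟦P⟧≈⟦Q⟧) (nf-⟦⟧ Q))

  length-⟦⟧ : ∀ P → length ⟦ P ⟧ ≡ size P
  length-⟦⟧ (k , t) = trans (List.length-++ (replicate k zero))
    (cong₂ _+_ (List.length-replicate k) (List.length-map suc t))

  ·-cancelˡ : ∀ P {Q Q′} → P · Q ≡ P · Q′ → Q ≡ Q′
  ·-cancelˡ (k , s) {zero  , t} {zero   , t′} eq = cong (zero ,_) (List.++-cancelˡ s t t′ (cong proj₂ eq))
  ·-cancelˡ (k , s) {suc l , t} {suc l′ , t′} eq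
    rewrite ℕ.+-cancelˡ-≡ (k + length s) l l′ (ℕ.suc-injective (cong proj₁ eq)) | cong proj₂ eq = refl
  ·-cancelˡ (k , s) {zero  , t} {suc l′ , t′} eq =
    ⊥-elim (ℕ.m≢1+m+n k (trans (cong proj₁ eq) (cong suc (ℕ.+-assoc k _ l′))))
  ·-cancelˡ (k , s) {suc l , t} {zero   , t′} eq =
    ⊥-elim (ℕ.m≢1+m+n k (trans (sym (cong proj₁ eq)) (cong suc (ℕ.+-assoc k _ l))))

  cancelˡ : LeftCancellative _≈_ _++_
  cancelˡ x y z xy≈xz = nf-injective (·-cancelˡ (nf x) (begin
    nf x · nf y  ≡⟨ nf-++ x y ⟨
    nf (x ++ y)  ≡⟨ nf-cong xy≈xz ⟩
    nf (x ++ z)  ≡⟨ nf-++ x z ⟩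
    nf x · nf z  ∎))
    where open ≡-Reasoning

module LeftDivisibility (m : ℕ) where

  open PresentedMonoid (relsM (suc m))
  open NormalForm m
  open PrefixOrder (Fin._≟_ {m})
  open Divisibility monoid using (_∣ˡ_; _,_)

  infix 4 _≼_
  data _≼_ : NF → NF → Set where
    below  : ∀ {P K T} → size P < K → P ≼ (K , T)
    prefix : ∀ {k s t} → s ⊑ t → (k , s) ≼ (k , t)

  ≼-refl : ∀ P → P ≼ P
  ≼-refl (k , s) = prefix (⊑-refl s)

  ≼-· : ∀ P Y → P ≼ P · Y
  ≼-· (k , s) (zero  , t) = prefix (⊑-refl s ++ᵖ t)
  ≼-· (k , s) (suc l , t) = below (s≤s (ℕ.m≤m+n (k + length s) l))

  ≼⇒· : ∀ {P Q} → P ≼ Q → ∃ λ Y → P · Y ≡ Q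
  ≼⇒· {k , s} (below {K = K} {T} size<K) =
    (suc (K ∸ suc (size (k , s))) , T) , cong (_, T) (ℕ.m+[n∸m]≡n size<K)
  ≼⇒· (prefix s⊑t) with (u , s++u≡t) ← Prefix-as-∣ˡ s⊑t = (zero , u) , cong (_ ,_) s++u≡t

  ∣ˡ⇒≼ : ∀ {x y} → x ∣ˡ y → nf x ≼ nf y
  ∣ˡ⇒≼ {x} (q , xq≈y) = subst (nf x ≼_) (trans (sym (nf-++ x q)) (nf-cong xq≈y)) (≼-· (nf x) (nf q))

  ≼⇒∣ˡ : ∀ {x y} → nf x ≼ nf y → x ∣ˡ y
  ≼⇒∣ˡ {x} {y} nfx≼nfy with (Y , nfx·Y≡nfy) ← ≼⇒· nfx≼nfy = ⟦ Y ⟧ , nf-injective (begin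
    nf (x ++ ⟦ Y ⟧)  ≡⟨ nf-++ x ⟦ Y ⟧ ⟩
    nf x · nf ⟦ Y ⟧  ≡⟨ cong (nf x ·_) (nf-⟦⟧ Y) ⟩
    nf x · Y         ≡⟨ nfx·Y≡nfy ⟩
    nf y             ∎)
    where open ≡-Reasoning

  _≼?_ : ∀ P Q → Dec (P ≼ Q)
  (k , s) ≼? (K , T) with k + length s ℕ.<? K
  ... | yes size<K = yes (below size<K)
  ... | no  size≮K with k ℕ.≟ K | prefix? Fin._≟_ s T
  ...   | yes refl | yes s⊑T = yes (prefix s⊑T)
  ...   | yes refl | no  s⋢T = no λ { (below size<K) → size≮K size<K ; (prefix s⊑T) → s⋢T s⊑T }
  ...   | no  k≢K  | _       = no λ { (below size<K) → size≮K size<K ; (prefix _) → k≢K refl }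

  open Order _≡_ _≼_

  size<upper-bound : ∀ {P Q C} → ¬ P ≼ Q → ¬ Q ≼ P → P ≼ C → Q ≼ C → size P < proj₁ C
  size<upper-bound _   _   (below size<K) _              = size<K
  size<upper-bound _   Q⋠P (prefix _)     (below size<K) = ⊥-elim (Q⋠P (below size<K))
  size<upper-bound P⋠Q Q⋠P (prefix s⊑T)   (prefix s′⊑T) with ⊑-total-below s⊑T s′⊑T
  ... | inj₁ s⊑s′ = ⊥-elim (P⋠Q (prefix s⊑s′))
  ... | inj₂ s′⊑s = ⊥-elim (Q⋠P (prefix s′⊑s))

  ≼-join : ∀ P Q → ∃ (IsLUB P Q)
  ≼-join P Q with Q ≼? P | P ≼? Q
  ... | yes Q≼P | _       = P , ≼-refl P , Q≼P , λ _ P≼C _ → P≼C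
  ... | no  _   | yes P≼Q = Q , P≼Q , ≼-refl Q , λ _ _ Q≼C → Q≼C
  ... | no  Q⋠P | no  P⋠Q = J , below (s≤s (ℕ.m≤m⊔n _ _)) , below (s≤s (ℕ.m≤n⊔m _ _)) , least
    where
    J = suc (size P ℕ.⊔ size Q) , []
    least : ∀ C → P ≼ C → Q ≼ C → J ≼ C
    least C P≼C Q≼C
      with ℕ.m≤n⇒m<n∨m≡n (ℕ.⊔-lub (size<upper-bound P⋠Q Q⋠P P≼C Q≼C) (size<upper-bound Q⋠P P⋠Q Q≼C P≼C))
    ... | inj₁ J<K  = below (subst (_< proj₁ C) (sym (ℕ.+-identityʳ _)) J<K)
    ... | inj₂ refl = prefix []

  ≼-meet-< : ∀ {k K} s T → k < K → ∃ (IsGLB (k , s) (K , T))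
  ≼-meet-< {k} {K} s T k<K =
    (k , take n s) , prefix (take-⊑ n s) , below (k+[≤n]<K (length-take≤ n s)) , greatest
    where
    n = K ∸ suc k
    length-take≤ : ∀ n (s : List (Fin m)) → length (take n s) ≤ n
    length-take≤ n s = ℕ.≤-trans (ℕ.≤-reflexive (List.length-take n s)) (ℕ.m⊓n≤m n (length s))
    k+[≤n]<K : ∀ {x} → x ≤ n → k + x < K
    k+[≤n]<K x≤n = ℕ.≤-trans (s≤s (ℕ.+-monoʳ-≤ k x≤n)) (ℕ.≤-reflexive (ℕ.m+[n∸m]≡n k<K))
    greatest : ∀ D → D ≼ (k , s) → D ≼ (K , T) → D ≼ (k , take n s)
    greatest _       (below size<k) _              = below size<k
    greatest (_ , u) (prefix u⊑s)   (below size<K) = prefix (⊑-take n u⊑s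
      (ℕ.m+n≤o⇒m≤o∸n (length u) (subst (_≤ K) (ℕ.+-comm (suc k) (length u)) size<K)))
    greatest _       (prefix _)     (prefix _)     = ⊥-elim (ℕ.<-irrefl refl k<K)

  ≼-meet : ∀ P Q → ∃ (IsGLB P Q)
  ≼-meet (k , s) (K , T) with ℕ.<-cmp k K
  ... | tri< k<K _ _ = ≼-meet-< s T k<K
  ... | tri> _ _ K<k with (G , G≼Q , G≼P , greatest) ← ≼-meet-< T s K<k =
    G , G≼P , G≼Q , λ D D≼P D≼Q → greatest D D≼Q D≼P
  ... | tri≈ _ refl _ = (k , lcp s T) , prefix (lcp-⊑ˡ s T) , prefix (lcp-⊑ʳ s T) , greatest
    where
    greatest : ∀ D → D ≼ (k , s) → D ≼ (k , T) → D ≼ (k , lcp s T)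
    greatest _ (below size<k) _              = below size<k
    greatest _ (prefix _)     (below size<k) = below size<k
    greatest _ (prefix u⊑s)   (prefix u⊑T)   = prefix (⊑-lcp u⊑s u⊑T)

module Enumeration (m : ℕ) where

  open NormalForm m using (NF; size)

  words : ℕ → List (List (Fin m))
  words zero    = [] ∷ []
  words (suc n) = cartesianProductWith _∷_ (allFin m) (words n)

  ∈-words : ∀ t → t ∈ words (length t)
  ∈-words []      = here refl
  ∈-words (j ∷ t) = List.∈-cartesianProductWith⁺ _∷_ (List.∈-allFin j) (∈-words t)

  words-length : ∀ n → All (λ t → length t ≡ n) (words n)
  words-length zero    = refl ∷ []
  words-length (suc n) = All.cartesianProductWith⁺ (≡.setoid _) (≡.setoid _) _∷_ (allFin m) (words n)
    (λ _ t∈ → cong suc (All.lookup (words-length n) t∈))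

  words-unique : ∀ n → Unique (words n)
  words-unique zero    = [] ∷ []
  words-unique (suc n) = Unique.cartesianProductWith⁺ _∷_ List.∷-injective (Unique.allFin⁺ m) (words-unique n)

  length-words : ∀ n → length (words n) ≡ m ^ n
  length-words zero    = refl
  length-words (suc n) = begin
    length (cartesianProductWith _∷_ (allFin m) (words n))
      ≡⟨ length-cartesianProductWith _∷_ (allFin m) (words n) ⟩
    length (allFin m) * length (words n)
      ≡⟨ cong₂ _*_ (length-allFin m) (length-words n) ⟩
    m * m ^ n ∎
    where open ≡-Reasoning

  normalForms : ℕ → List NF
  normalForms zero    = (zero , []) ∷ []
  normalForms (suc n) = map (zero ,_) (words (suc n)) ++ map (map₁ suc) (normalForms n)

  ∈-normalForms : ∀ P → P ∈ normalForms (size P)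
  ∈-normalForms (zero  , [])    = here refl
  ∈-normalForms (zero  , j ∷ t) = Any.++⁺ˡ (List.∈-map⁺ (zero ,_) (∈-words (j ∷ t)))
  ∈-normalForms (suc k , t)     = Any.++⁺ʳ _ (List.∈-map⁺ (map₁ suc) (∈-normalForms (k , t)))

  normalForms-size : ∀ n → All (λ P → size P ≡ n) (normalForms n)
  normalForms-size zero    = refl ∷ []
  normalForms-size (suc n) =
    All.++⁺ (All.map⁺ (words-length (suc n))) (All.map⁺ (All.map (cong suc) (normalForms-size n)))

  normalForms-unique : ∀ n → Unique (normalForms n)
  normalForms-unique zero    = [] ∷ []
  normalForms-unique (suc n) =
    Unique.++⁺ (Unique.map⁺ (cong proj₂) (words-unique (suc n)))
               (Unique.map⁺ (λ { refl → refl }) (normalForms-unique n))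
               disjoint
    where
    disjoint : Disjoint (map (zero ,_) (words (suc n))) (map (map₁ suc) (normalForms n))
    disjoint (P∈₁ , P∈₂) with List.∈-map⁻ (zero ,_) P∈₁ | List.∈-map⁻ (map₁ suc) P∈₂
    ... | _ , _ , refl | _ , _ , ()

  length-normalForms : ∀ n → length (normalForms (suc n)) ≡ m ^ suc n + length (normalForms n)
  length-normalForms n = begin
    length (map (zero ,_) (words (suc n)) ++ map (map₁ suc) (normalForms n))
      ≡⟨ List.length-++ (map (zero ,_) (words (suc n))) ⟩
    length (map (zero ,_) (words (suc n))) + length (map (map₁ suc) (normalForms n))
      ≡⟨ cong₂ _+_ (List.length-map _ (words (suc n))) (List.length-map _ (normalForms n)) ⟩
    length (words (suc n)) + length (normalForms n)
      ≡⟨ cong (_+ length (normalForms n)) (length-words (suc n)) ⟩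
    m ^ suc n + length (normalForms n) ∎
    where open ≡-Reasoning

  rankSize : ℕ → ℕ
  rankSize n = length (normalForms n)

  rankSize-recurrence : ∀ n → rankSize (2 + n) + m * rankSize n ≡ suc m * rankSize (1 + n)
  rankSize-recurrence n = begin
    a (2 + n) + m * a n                  ≡⟨ cong (_+ m * a n) (length-normalForms (1 + n)) ⟩
    m ^ (2 + n) + a (1 + n) + m * a n    ≡⟨ regroup m (m ^ (1 + n)) (a (1 + n)) (a n) ⟩
    a (1 + n) + m * (m ^ (1 + n) + a n)  ≡⟨ cong (λ k → a (1 + n) + m * k) (length-normalForms n) ⟨
    a (1 + n) + m * a (1 + n)            ∎
    where
    open ≡-Reasoning
    a = rankSize
    regroup : ∀ m X A₁ A₀ → m * X + A₁ + m * A₀ ≡ A₁ + m * (X + A₀)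
    regroup = ℕ-Solver.solve-∀

  rankSize-inverse : IsInverseSeries rankSize (poly (suc m))
  rankSize-inverse = InverseSeries.isInverseSeries-poly m rankSize refl rankSize₁ rankSize-recurrence
    where
    rankSize₁ : rankSize 1 ≡ suc m
    rankSize₁ = trans (length-normalForms 0) (trans (cong (_+ 1) (ℕ.*-identityʳ m)) (ℕ.+-comm m 1))

module UphoStructure (m : ℕ) where

  open PresentedMonoid (relsM (suc m))
  open HomogeneousPresentation (relsM-homogeneous (suc m))
  open NormalForm m
  open LeftDivisibility m
  open Enumeration m
  open LeftCancellativeMonoid monoid cancelˡ
  open Divisibility monoid using (_∣ˡ_; ε∣ˡ_)
  open Order _≈_ _∣ˡ_

  ≼⇒∣ˡ⟦⟧ : ∀ {x} J → nf x ≼ J → x ∣ˡ ⟦ J ⟧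
  ≼⇒∣ˡ⟦⟧ {x} J = ≼⇒∣ˡ ∘ subst (nf x ≼_) (sym (nf-⟦⟧ J))

  ≼⇒⟦⟧∣ˡ : ∀ {y} J → J ≼ nf y → ⟦ J ⟧ ∣ˡ y
  ≼⇒⟦⟧∣ˡ {y} J = ≼⇒∣ˡ ∘ subst (_≼ nf y) (sym (nf-⟦⟧ J))

  join : ∀ p q → ∃ (IsLUB p q)
  join p q with (J , p≼J , q≼J , least) ← ≼-join (nf p) (nf q) =
    ⟦ J ⟧ , ≼⇒∣ˡ⟦⟧ J p≼J , ≼⇒∣ˡ⟦⟧ J q≼J ,
    λ c p∣c q∣c → ≼⇒⟦⟧∣ˡ J (least (nf c) (∣ˡ⇒≼ p∣c) (∣ˡ⇒≼ q∣c))

  meet : ∀ p q → ∃ (IsGLB p q)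
  meet p q with (G , G≼p , G≼q , greatest) ← ≼-meet (nf p) (nf q) =
    ⟦ G ⟧ , ≼⇒⟦⟧∣ˡ G G≼p , ≼⇒⟦⟧∣ˡ G G≼q ,
    λ c c∣p c∣q → ≼⇒∣ˡ⟦⟧ G (greatest (nf c) (∣ˡ⇒≼ c∣p) (∣ˡ⇒≼ c∣q))

  size-nf : ∀ w → size (nf w) ≡ length w
  size-nf w = trans (sym (length-⟦⟧ (nf w))) (sym (length-cong (≈⟦nf⟧ w)))

  rankCount : ∀ n → RankCount length n (rankSize n)
  rankCount n = map ⟦_⟧ (normalForms n)
              , List.length-map ⟦_⟧ (normalForms n)
              , All.map⁺ (All.map (λ {P} size≡n → trans (length-⟦⟧ P) size≡n) (normalForms-size n))
              , AllPairs.map⁺ (AllPairs.map (λ P≢Q → P≢Q ∘ ⟦⟧-injective) (normalForms-unique n))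
              , complete
    where
    complete : ∀ p → length p ≡ n → Any (p ≈_) (map ⟦_⟧ (normalForms n))
    complete p refl = Any.map⁺ (Any.map (λ { refl → ≈⟦nf⟧ p })
      (subst (λ k → nf p ∈ normalForms k) (size-nf p) (∈-normalForms (nf p))))

  isUphoLattice : IsUphoLattice _≈_ _∣ˡ_ length
  isUphoLattice = record
    { isPartialOrder = ∣ˡ-isPartialOrder
    ; bottom         = []
    ; bottom-min     = ε∣ˡ_
    ; ρ-cong         = length-cong
    ; ρ-bottom       = refl
    ; ρ-strict       = length-strict
    ; ρ-cover        = length-cover
    ; finiteType     = λ n → let (l , _ , _ , _ , complete) = rankCount n in l , complete
    ; joins          = join
    ; meets          = meet
    ; twoElements    = [] , zero ∷ [] , λ ε≈x₁ → ℕ.0≢1+n (length-cong ε≈x₁)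
    ; upho           = filter≅carrier
    }

module CoreMr (m : ℕ) where

  open PresentedMonoid (relsM (2 + m))
  open HomogeneousPresentation (relsM-homogeneous (2 + m))
  open NormalForm (suc m)
  open LeftDivisibility (suc m)
  open Divisibility monoid using (_∣ˡ_; ε∣ˡ_; ∣ˡ-refl)
  open Order _≈_ _∣ˡ_
  open IsEquivalence ≈-isEquivalence using () renaming (refl to ≈-refl)

  x₁x₁ : Word (2 + m)
  x₁x₁ = zero ∷ zero ∷ []

  toMr : NF → MrEl (2 + m)
  toMr (zero , [])     = bot
  toMr (zero , j ∷ []) = atom (suc j)
  toMr (1 , [])        = atom zero
  toMr _               = top

  word : MrEl (2 + m) → Word (2 + m)
  word bot      = []
  word (atom i) = i ∷ []
  word top      = x₁x₁

  data DivisorOfX₁x₁ : NF → Set where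
    ε-div    : DivisorOfX₁x₁ (zero , [])
    x₁-div   : DivisorOfX₁x₁ (1 , [])
    xⱼ-div   : ∀ j → DivisorOfX₁x₁ (zero , j ∷ [])
    x₁x₁-div : DivisorOfX₁x₁ (2 , [])

  divisorOfX₁x₁ : ∀ {P} → P ≼ (2 , []) → DivisorOfX₁x₁ P
  divisorOfX₁x₁ {zero , []}        (below _) = ε-div
  divisorOfX₁x₁ {zero , j ∷ []}    (below _) = xⱼ-div j
  divisorOfX₁x₁ {1 , []}           (below _) = x₁-div
  divisorOfX₁x₁ {zero , _ ∷ _ ∷ _} (below (s≤s (s≤s ())))
  divisorOfX₁x₁ {1 , _ ∷ _}        (below (s≤s (s≤s ())))
  divisorOfX₁x₁ {suc (suc _) , _}  (below (s≤s (s≤s ())))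
  divisorOfX₁x₁ (prefix [])        = x₁x₁-div

  nf-word-toMr : ∀ {P} → DivisorOfX₁x₁ P → nf (word (toMr P)) ≡ P
  nf-word-toMr ε-div      = refl
  nf-word-toMr x₁-div     = refl
  nf-word-toMr (xⱼ-div _) = refl
  nf-word-toMr x₁x₁-div   = refl

  word∣x₁x₁ : ∀ x → word x ∣ˡ x₁x₁
  word∣x₁x₁ bot            = ε∣ˡ x₁x₁
  word∣x₁x₁ (atom zero)    = ≼⇒∣ˡ (below (s≤s (s≤s z≤n)))
  word∣x₁x₁ (atom (suc _)) = ≼⇒∣ˡ (below (s≤s (s≤s z≤n)))
  word∣x₁x₁ top            = ∣ˡ-refl

  toMr-mono : ∀ {P Q} → P ≼ Q → DivisorOfX₁x₁ Q → toMr P ≤Mr toMr Q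
  toMr-mono _                                x₁x₁-div   = ≤top
  toMr-mono (prefix [])                      ε-div      = bot≤
  toMr-mono (prefix [])                      x₁-div     = atom≤
  toMr-mono (below {zero , []} _)            x₁-div     = bot≤
  toMr-mono (below {suc _ , _} (s≤s ()))     x₁-div
  toMr-mono (below {zero , _ ∷ _} (s≤s ()))  x₁-div
  toMr-mono (prefix [])                      (xⱼ-div _) = bot≤
  toMr-mono (prefix (refl ∷ []))             (xⱼ-div _) = atom≤

  interval≅Mr : OrderIso {Interval [] x₁x₁} {MrEl (2 + m)}
    (λ x y → proj₁ x ≈ proj₁ y) (λ x y → proj₁ x ∣ˡ proj₁ y) _≡_ _≤Mr_
  interval≅Mr = record
    { to        = toMr ∘ nf ∘ proj₁
    ; from      = λ x → word x , (ε∣ˡ word x) , word∣x₁x₁ x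
    ; to-cong   = cong toMr ∘ nf-cong
    ; from-cong = λ { refl → ≈-refl }
    ; from-to   = λ x → nf-injective (nf-word-toMr (divisorOfX₁x₁ (∣ˡ⇒≼ (proj₂ (proj₂ x)))))
    ; to-from   = λ { bot → refl ; (atom zero) → refl ; (atom (suc _)) → refl ; top → refl }
    ; to-mono   = λ {x} {y} x∣y → toMr-mono (∣ˡ⇒≼ x∣y) (divisorOfX₁x₁ (∣ˡ⇒≼ (proj₂ (proj₂ y))))
    ; from-mono = λ { bot≤ → ε∣ˡ _ ; (≤top {x}) → word∣x₁x₁ x ; atom≤ → ∣ˡ-refl }
    }

  atom∣x₁x₁ : ∀ s → [] ⋖ s → s ∣ˡ x₁x₁
  atom∣x₁x₁ (i ∷ [])    _   = word∣x₁x₁ (atom i)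
  atom∣x₁x₁ []          ε⋖s with () ← length-cover ε⋖s
  atom∣x₁x₁ (_ ∷ _ ∷ _) ε⋖s with () ← length-cover ε⋖s

  x₁x₁≼ : ∀ {j} Q → (1 , []) ≼ Q → (zero , j ∷ []) ≼ Q → (2 , []) ≼ Q
  x₁x₁≼ (2 , _)                 _                _ = prefix []
  x₁x₁≼ (suc (suc (suc _)) , _) _                _ = below (s≤s (s≤s (s≤s z≤n)))
  x₁x₁≼ (1 , _)                 (prefix _)       (below (s≤s ()))
  x₁x₁≼ (1 , _)                 (below (s≤s ())) _
  x₁x₁≼ (0 , _)                 (below ())       _

  x₁x₁-least : ∀ u → (∀ s → [] ⋖ s → s ∣ˡ u) → x₁x₁ ∣ˡ u
  x₁x₁-least u atoms∣u = ≼⇒∣ˡ (x₁x₁≼ (nf u) (∣ˡ⇒≼ (atoms∣u (zero ∷ []) ε⋖[ zero ]))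
                                            (∣ˡ⇒≼ (atoms∣u (suc zero ∷ []) ε⋖[ suc zero ])))

theorem4p2 : (r : ℕ) → 2 ≤ r →
    let M = MonoidM r
        open RawMonoid M
        open Order _≈_ (LeftDiv M)
    in HomogeneouslyFinitelyGenerated M
     × LeftCancellative _≈_ _∙_
     × HasLeastCommonRightMultiples M
     × (Σ (Carrier → ℕ) λ ρ → IsUphoLattice _≈_ (LeftDiv M) ρ
          × (Σ (ℕ → ℕ) λ a → (∀ n → RankCount ρ n (a n)) × IsInverseSeries a (poly r)))
     × (Σ Carrier λ t →
          (∀ s → ε ⋖ s → LeftDiv M s t)
          × (∀ u → (∀ s → ε ⋖ s → LeftDiv M s u) → LeftDiv M t u)
          × OrderIso {Interval ε t} {MrEl r}
              (λ x y → Σ.proj₁ x ≈ Σ.proj₁ y) (λ x y → LeftDiv M (Σ.proj₁ x) (Σ.proj₁ y))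
              _≡_ _≤Mr_)
     × (Σ (MrEl r → ℤ) λ μ → IsMobiusMr r μ × (∀ k → chiStarCoeff r μ k ≡ poly r k))
theorem4p2 (suc (suc m)) (s≤s (s≤s z≤n)) =
    PresentedMonoid.homogeneouslyFinitelyGenerated (relsM (2 + m)) (relsM-homogeneous (2 + m))
  , NormalForm.cancelˡ (suc m)
  , join
  , (length , isUphoLattice , rankSize , rankCount , rankSize-inverse)
  , (x₁x₁ , atom∣x₁x₁ , x₁x₁-least , interval≅Mr)
  , (μ , isMobius , chiStar)
  where
  open UphoStructure (suc m)
  open Enumeration (suc m) using (rankSize; rankSize-inverse)
  open CoreMr m using (x₁x₁; atom∣x₁x₁; x₁x₁-least; interval≅Mr)
  open MobiusMr (2 + m)
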